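{- $\mathsf{ICK}\oplus(p>p)$ is sound and complete with respect to the class of conditional Kripke frames $(X,\le,\mathcal R)$ satisfying $R_a[x]\subseteq a$ for all $x\in X$ and all upsets $a$ of $(X,\le)$.
   Context: Formulas: $\phi::=p\mid\bot\mid\phi\wedge\phi\mid\phi\vee\phi\mid\phi\to\phi\mid\phi>\phi$, $\top:=\bot\to\bot$. $\mathsf{ICK}\oplus\Gamma$ is the smallest set of formulas containing the axioms of intuitionistic propositional logic, $\Gamma$, $(p>(q\wedge r))\leftrightarrow((p>q)\wedge(p>r))$ and $(p>\top)\leftrightarrow\top$, closed under uniform substitution, modus ponens and: from $\phi\leftrightarrow\psi$ infer $(\phi>\chi)\leftrightarrow(\psi>\chi)$ and $(\chi>\phi)\leftrightarrow(\chi>\psi)$. A conditional Kripke frame is $(X,\le,\mathcal R)$, $(X,\le)$ a nonempty preorder, $\mathcal R=\{R_a: a\text{ upset}\}$ such that $x\le yR_az$ implies $xR_aw\le z$ for some $w$; $R_a[x]=\{y:xR_ay\}$. Valuations map variables to upsets; intuitionistic Kripke clauses and $x\models\phi>\psi$ iff every $y$ with $xR_{V(\phi)}y$ satisfies $\psi$. Sound and complete w.r.t. a class: the logic's members are exactly the formulas valid on all frames in the class. -}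

module Defs where

open import Level using (Level; Lift; lift; Setω) renaming (suc to lsuc)
open import Data.Nat using (ℕ)
open import Data.Product using (Σ; _×_; _,_; proj₁; proj₂)
open import Data.Sum using (_⊎_; inj₁; inj₂)
open import Data.Empty using (⊥)
open import Axiom.ExcludedMiddle using (ExcludedMiddle)

infixr 6 _∧'_
infixr 5 _∨'_
infixr 4 _⇒_ _▷_
infix  3 _⇔'_

data Fm : Set where
  var  : ℕ → Fm
  bot  : Fm
  _∧'_ : Fm → Fm → Fm
  _∨'_ : Fm → Fm → Fm
  _⇒_  : Fm → Fm → Fm
  _▷_  : Fm → Fm → Fm

top : Fm
top = bot ⇒ bot

_⇔'_ : Fm → Fm → Fm
φ ⇔' ψ = (φ ⇒ ψ) ∧' (ψ ⇒ φ)

subst : (ℕ → Fm) → Fm → Fm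
subst σ (var n)  = σ n
subst σ bot      = bot
subst σ (φ ∧' ψ) = subst σ φ ∧' subst σ ψ
subst σ (φ ∨' ψ) = subst σ φ ∨' subst σ ψ
subst σ (φ ⇒ ψ)  = subst σ φ ⇒ subst σ ψ
subst σ (φ ▷ ψ)  = subst σ φ ▷ subst σ ψ

p q r : Fm
p = var 0
q = var 1
r = var 2

data Axiom : Fm → Set where
  ax-K    : Axiom (p ⇒ (q ⇒ p))
  ax-S    : Axiom ((p ⇒ (q ⇒ r)) ⇒ ((p ⇒ q) ⇒ (p ⇒ r)))
  ax-∧E₁  : Axiom ((p ∧' q) ⇒ p)
  ax-∧E₂  : Axiom ((p ∧' q) ⇒ q)
  ax-∧I   : Axiom (p ⇒ (q ⇒ (p ∧' q)))
  ax-∨I₁  : Axiom (p ⇒ (p ∨' q))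
  ax-∨I₂  : Axiom (q ⇒ (p ∨' q))
  ax-∨E   : Axiom ((p ⇒ r) ⇒ ((q ⇒ r) ⇒ ((p ∨' q) ⇒ r)))
  ax-⊥E   : Axiom (bot ⇒ p)
  ax-id   : Axiom (p ▷ p)
  ax-C∧   : Axiom ((p ▷ (q ∧' r)) ⇔' ((p ▷ q) ∧' (p ▷ r)))
  ax-C⊤   : Axiom ((p ▷ top) ⇔' top)

data ICKid : Fm → Set where
  axiom : ∀ {φ} → Axiom φ → ICKid φ
  usubst : ∀ {φ} (σ : ℕ → Fm) → ICKid φ → ICKid (subst σ φ)
  mp    : ∀ {φ ψ} → ICKid (φ ⇒ ψ) → ICKid φ → ICKid ψ
  congL : ∀ {φ ψ χ} → ICKid (φ ⇔' ψ) → ICKid ((φ ▷ χ) ⇔' (ψ ▷ χ))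
  congR : ∀ {φ ψ χ} → ICKid (φ ⇔' ψ) → ICKid ((χ ▷ φ) ⇔' (χ ▷ ψ))

-- Since R is indexed by upsets-as-sets, we require R_a to depend only
-- on the extension of a (field R-ext).
record Upset {ℓ} (X : Set ℓ) (_≤_ : X → X → Set ℓ) : Set (lsuc ℓ) where
  field
    mem : X → Set ℓ
    up  : ∀ {x y} → x ≤ y → mem x → mem y
open Upset public

record Frame (ℓ : Level) : Set (lsuc ℓ) where
  field
    X       : Set ℓ
    _≤_     : X → X → Set ℓ
    ≤-refl  : ∀ {x} → x ≤ x
    ≤-trans : ∀ {x y z} → x ≤ y → y ≤ z → x ≤ z
    inhabited : X
    R       : Upset X _≤_ → X → X → Set ℓ
    R-ext   : ∀ (a b : Upset X _≤_) → (∀ x → (mem a x → mem b x) × (mem b x → mem a x))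
              → ∀ x y → (R a x y → R b x y) × (R b x y → R a x y)
    frameCond : ∀ a {x y z} → x ≤ y → R a y z → Σ X λ w → R a x w × w ≤ z

module Semantics {ℓ} (F : Frame ℓ) where
  open Frame F

  Valuation : Set (lsuc ℓ)
  Valuation = ℕ → Upset X _≤_

  mutual
    Forces : Valuation → X → Fm → Set ℓ
    Forces V x (var n)  = mem (V n) x
    Forces V x bot      = Lift ℓ ⊥
    Forces V x (φ ∧' ψ) = Forces V x φ × Forces V x ψ
    Forces V x (φ ∨' ψ) = Forces V x φ ⊎ Forces V x ψ
    Forces V x (φ ⇒ ψ)  = ∀ y → x ≤ y → Forces V y φ → Forces V y ψ
    Forces V x (φ ▷ ψ)  = ∀ y → R (truthSet V φ) x y → Forces V y ψ

    truthSet : Valuation → Fm → Upset X _≤_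
    truthSet V φ = record { mem = λ x → Forces V x φ ; up = persist V φ }

    persist : ∀ V φ {x y} → x ≤ y → Forces V x φ → Forces V y φ
    persist V (var n)  le h = up (V n) le h
    persist V bot      le h = h
    persist V (φ ∧' ψ) le (h₁ , h₂) = persist V φ le h₁ , persist V ψ le h₂
    persist V (φ ∨' ψ) le (inj₁ h) = inj₁ (persist V φ le h)
    persist V (φ ∨' ψ) le (inj₂ h) = inj₂ (persist V ψ le h)
    persist V (φ ⇒ ψ)  le h = λ z y≤z hz → h z (≤-trans le y≤z) hz
    persist V (φ ▷ ψ)  le h = λ z yRz →
      let (w , xRw , w≤z) = frameCond (truthSet V φ) le yRz
      in persist V ψ w≤z (h w xRw)

Valid : ∀ {ℓ} → Frame ℓ → Fm → Set (lsuc ℓ)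
Valid F φ = ∀ V x → Forces V x φ
  where open Semantics F

Identity : ∀ {ℓ} → Frame ℓ → Set (lsuc ℓ)
Identity F = ∀ a x y → R a x y → mem a y
  where open Frame F

record SoundComplete : Setω where
  field
    sound    : ∀ {ℓ} φ → ICKid φ → (F : Frame ℓ) → Identity F → Valid F φ
    complete : (∀ {ℓ} → ExcludedMiddle ℓ) →
               ∀ φ → (∀ {ℓ} (F : Frame ℓ) → Identity F → Valid F φ) → ICKid φ

-- Soundness is induction on derivations: p ▷ p is valid because R_a[x] ⊆ a, and
-- the substitution rule is sound because forcing a substitution instance is forcing the
-- original formula under the substituted valuation (this uses that R_a depends only on
-- the extension of a).
--
-- Completeness uses the canonical frame of prime theories, ordered by inclusion, where
-- s R_a t holds when a is the set of prime theories containing some ψ and t contains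
-- every χ with ψ ▷ χ ∈ s. The axiom p ▷ p gives R_a[s] ⊆ a. In the truth lemma for
-- A ▷ B, the ICK axioms make {χ ∣ A ▷ χ ∈ t} deductively closed, so a prime theory
-- separating it from B (Lindenbaum, over an enumeration of formulas and with excluded
-- middle) refutes A ▷ B; conversely, if ψ and A lie in the same prime theories then
-- ψ ⇔ A is provable and the congruence rule turns A ▷ B ∈ t into ψ ▷ B ∈ t.

module Submission where

open import Defs
open import Level using (Lift; lift; lower; 0ℓ) renaming (suc to lsuc)
open import Data.Empty using (⊥; ⊥-elim)
open import Data.Unit using (⊤; tt)
open import Data.Nat using (ℕ; zero; suc; _+_; _≤_; _⊔_; s≤s; _≤′_; ≤′-refl; ≤′-step)
import Data.Nat.Properties as ℕ
open import Data.Nat.Properties using (+-suc; +-identityʳ)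
open import Data.Product using (Σ; ∃; _×_; _,_; proj₁; proj₂)
import Data.Product as Product
open import Data.Sum using (_⊎_; inj₁; inj₂; [_,_])
import Data.Sum as Sum
open import Function using (id; _∘_)
open import Function.Bundles using (_⇔_; mk⇔; Equivalence)
open Equivalence using (to; from)
open import Function.Construct.Symmetry using (⇔-sym)
open import Function.Construct.Composition using (_⇔-∘_)
open import Relation.Binary.PropositionalEquality using (_≡_; refl; cong; cong₂; trans; module ≡-Reasoning)
open import Relation.Nullary using (¬_; yes; no)
open import Axiom.ExcludedMiddle using (ExcludedMiddle)

module FrameSoundness {ℓ} (F : Frame ℓ) (identity : Identity F) where
  open Frame F
  open Semantics F

  R-cong : ∀ {a b x y} → (∀ z → mem a z ⇔ mem b z) → R a x y → R b x y
  R-cong {a} {b} {x} {y} a≡b = proj₁ (R-ext a b (λ z → to (a≡b z) , from (a≡b z)) x y)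

  forces-subst : ∀ V σ φ x → Forces V x (subst σ φ) ⇔ Forces (λ n → truthSet V (σ n)) x φ
  forces-subst V σ (var n) x = mk⇔ id id
  forces-subst V σ bot x = mk⇔ id id
  forces-subst V σ (φ ∧' ψ) x =
    mk⇔ (Product.map (to (forces-subst V σ φ x)) (to (forces-subst V σ ψ x)))
        (Product.map (from (forces-subst V σ φ x)) (from (forces-subst V σ ψ x)))
  forces-subst V σ (φ ∨' ψ) x =
    mk⇔ (Sum.map (to (forces-subst V σ φ x)) (to (forces-subst V σ ψ x)))
        (Sum.map (from (forces-subst V σ φ x)) (from (forces-subst V σ ψ x)))
  forces-subst V σ (φ ⇒ ψ) x =
    mk⇔ (λ h y x≤y hφ → to (forces-subst V σ ψ y) (h y x≤y (from (forces-subst V σ φ y) hφ)))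
        (λ h y x≤y hφ → from (forces-subst V σ ψ y) (h y x≤y (to (forces-subst V σ φ y) hφ)))
  forces-subst V σ (φ ▷ ψ) x =
    mk⇔ (λ h y xRy → to (forces-subst V σ ψ y) (h y (R-cong (λ z → ⇔-sym (forces-subst V σ φ z)) xRy)))
        (λ h y xRy → from (forces-subst V σ ψ y) (h y (R-cong (forces-subst V σ φ) xRy)))

  axiom-valid : ∀ {φ} → Axiom φ → Valid F φ
  axiom-valid ax-K    V _ _ _ hp y z≤y _ = up (V 0) z≤y hp
  axiom-valid ax-S    V _ _ _ f _ y≤z g w z≤w hp = f w (≤-trans y≤z z≤w) hp w ≤-refl (g w z≤w hp)
  axiom-valid ax-∧E₁  V _ _ _ = proj₁
  axiom-valid ax-∧E₂  V _ _ _ = proj₂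
  axiom-valid ax-∧I   V _ _ _ hp _ y≤z hq = up (V 0) y≤z hp , hq
  axiom-valid ax-∨I₁  V _ _ _ = inj₁
  axiom-valid ax-∨I₂  V _ _ _ = inj₂
  axiom-valid ax-∨E   V _ _ _ f _ y≤z g w z≤w = [ f w (≤-trans y≤z z≤w) , g w z≤w ]
  axiom-valid ax-⊥E   V _ _ _ (lift ())
  axiom-valid ax-id   V x = identity (truthSet V p) x
  axiom-valid ax-C∧   V _ =
      (λ _ _ h → (λ z xRz → proj₁ (h z xRz)) , (λ z xRz → proj₂ (h z xRz)))
    , (λ _ _ h z xRz → proj₁ h z xRz , proj₂ h z xRz)
  axiom-valid ax-C⊤   V _ = (λ _ _ _ _ _ → id) , (λ _ _ _ _ _ _ _ → id)

  sound : ∀ {φ} → ICKid φ → Valid F φ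
  sound (axiom a) = axiom-valid a
  sound (usubst {φ} σ d) V x = from (forces-subst V σ φ x) (sound d _ x)
  sound (mp d e) V x = sound d V x x ≤-refl (sound e V x)
  sound (congL {φ} {ψ} {χ} d) V _ =
      (λ _ _ h z yRz → h z (R-cong (λ w → mk⇔ (ψ→φ w) (φ→ψ w)) yRz))
    , (λ _ _ h z yRz → h z (R-cong (λ w → mk⇔ (φ→ψ w) (ψ→φ w)) yRz))
    where
    φ→ψ : ∀ w → Forces V w φ → Forces V w ψ
    φ→ψ w = proj₁ (sound d V w) w ≤-refl
    ψ→φ : ∀ w → Forces V w ψ → Forces V w φ
    ψ→φ w = proj₂ (sound d V w) w ≤-refl
  sound (congR d) V _ =
      (λ _ _ h z yRz → proj₁ (sound d V z) z ≤-refl (h z yRz))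
    , (λ _ _ h z yRz → proj₂ (sound d V z) z ≤-refl (h z yRz))

soundness : ∀ {ℓ} φ → ICKid φ → (F : Frame ℓ) → Identity F → Valid F φ
soundness φ d F identity = FrameSoundness.sound F identity d

module Enumeration where

  -- Walks the diagonals of ℕ × ℕ: (0,0), (0,1), (1,0), (0,2), (1,1), (2,0), …
  next : ℕ × ℕ → ℕ × ℕ
  next (a , zero)  = 0 , suc a
  next (a , suc b) = suc a , b

  unpair : ℕ → ℕ × ℕ
  unpair zero    = 0 , 0
  unpair (suc n) = next (unpair n)

  unpair-onto : ∀ s a b → a + b ≡ s → ∃ λ n → unpair n ≡ (a , b)
  unpair-onto _       zero    zero    _  = 0 , refl
  unpair-onto zero    zero    (suc b) ()
  unpair-onto (suc s) zero    (suc b) eq =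
    Product.map suc (cong next) (unpair-onto s b zero (trans (+-identityʳ b) (ℕ.suc-injective eq)))
  unpair-onto s       (suc a) b       eq =
    Product.map suc (cong next) (unpair-onto s a (suc b) (trans (+-suc a b) eq))

  pair : ℕ → ℕ → ℕ
  pair a b = proj₁ (unpair-onto (a + b) a b refl)

  unpair-pair : ∀ a b → unpair (pair a b) ≡ (a , b)
  unpair-pair a b = proj₂ (unpair-onto (a + b) a b refl)

  connective : ℕ → Fm → Fm → Fm
  connective 0 = _∧'_
  connective 1 = _∨'_
  connective 2 = _⇒_
  connective _ = _▷_

  -- The first argument is fuel; a code (pair tag m) decodes to a variable (tag 0),
  -- ⊥ (tag 1) or a binary connective applied to the decodings of unpair m.
  mutual
    decode : ℕ → ℕ → Fm
    decode zero    _ = bot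
    decode (suc f) n = decodeTagged f (unpair n)

    decodeTagged : ℕ → ℕ × ℕ → Fm
    decodeTagged f (zero , m)        = var m
    decodeTagged f (suc zero , _)    = bot
    decodeTagged f (suc (suc k) , m) =
      connective k (decode f (proj₁ (unpair m))) (decode f (proj₂ (unpair m)))

  encodeBinary : ℕ → ℕ → ℕ → ℕ
  encodeBinary k i j = pair (suc (suc k)) (pair i j)

  encode : Fm → ℕ
  encode (var m)  = pair 0 m
  encode bot      = pair 1 0
  encode (φ ∧' ψ) = encodeBinary 0 (encode φ) (encode ψ)
  encode (φ ∨' ψ) = encodeBinary 1 (encode φ) (encode ψ)
  encode (φ ⇒ ψ)  = encodeBinary 2 (encode φ) (encode ψ)
  encode (φ ▷ ψ)  = encodeBinary 3 (encode φ) (encode ψ)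

  depth : Fm → ℕ
  depth (var _)  = 1
  depth bot      = 1
  depth (φ ∧' ψ) = suc (depth φ ⊔ depth ψ)
  depth (φ ∨' ψ) = suc (depth φ ⊔ depth ψ)
  depth (φ ⇒ ψ)  = suc (depth φ ⊔ depth ψ)
  depth (φ ▷ ψ)  = suc (depth φ ⊔ depth ψ)

  decode-encodeBinary : ∀ f k i j →
    decode (suc f) (encodeBinary k i j) ≡ connective k (decode f i) (decode f j)
  decode-encodeBinary f k i j = begin
    decodeTagged f (unpair (pair (suc (suc k)) (pair i j)))
      ≡⟨ cong (decodeTagged f) (unpair-pair (suc (suc k)) (pair i j)) ⟩
    connective k (decode f (proj₁ (unpair (pair i j)))) (decode f (proj₂ (unpair (pair i j))))
      ≡⟨ cong (λ ij → connective k (decode f (proj₁ ij)) (decode f (proj₂ ij))) (unpair-pair i j) ⟩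
    connective k (decode f i) (decode f j) ∎
    where open ≡-Reasoning

  decode-encode : ∀ φ f → depth φ ≤ f → decode f (encode φ) ≡ φ

  decode-encode-connective : ∀ k φ ψ f → depth φ ⊔ depth ψ ≤ f →
    decode (suc f) (encodeBinary k (encode φ) (encode ψ)) ≡ connective k φ ψ
  decode-encode-connective k φ ψ f d≤f = trans (decode-encodeBinary f k (encode φ) (encode ψ))
    (cong₂ (connective k)
      (decode-encode φ f (ℕ.≤-trans (ℕ.m≤m⊔n (depth φ) (depth ψ)) d≤f))
      (decode-encode ψ f (ℕ.≤-trans (ℕ.m≤n⊔m (depth φ) (depth ψ)) d≤f)))

  decode-encode (var m)  (suc f) _ = cong (decodeTagged f) (unpair-pair 0 m)
  decode-encode bot      (suc f) _ = cong (decodeTagged f) (unpair-pair 1 0)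
  decode-encode (φ ∧' ψ) (suc f) (s≤s d≤f) = decode-encode-connective 0 φ ψ f d≤f
  decode-encode (φ ∨' ψ) (suc f) (s≤s d≤f) = decode-encode-connective 1 φ ψ f d≤f
  decode-encode (φ ⇒ ψ)  (suc f) (s≤s d≤f) = decode-encode-connective 2 φ ψ f d≤f
  decode-encode (φ ▷ ψ)  (suc f) (s≤s d≤f) = decode-encode-connective 3 φ ψ f d≤f

  enum : ℕ → Fm
  enum n = decode (proj₁ (unpair n)) (proj₂ (unpair n))

  enum-onto : ∀ φ → ∃ λ n → enum n ≡ φ
  enum-onto φ = pair (depth φ) (encode φ) ,
    trans (cong (λ fn → decode (proj₁ fn) (proj₂ fn)) (unpair-pair (depth φ) (encode φ)))
          (decode-encode φ (depth φ) ℕ.≤-refl)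

module ICK where

  private
    instantiate : Fm → Fm → Fm → ℕ → Fm
    instantiate A B C 0 = A
    instantiate A B C 1 = B
    instantiate A B C _ = C

  K : ∀ A B → ICKid (A ⇒ (B ⇒ A))
  K A B = usubst (instantiate A B bot) (axiom ax-K)

  S : ∀ A B C → ICKid ((A ⇒ (B ⇒ C)) ⇒ ((A ⇒ B) ⇒ (A ⇒ C)))
  S A B C = usubst (instantiate A B C) (axiom ax-S)

  ∧-elimˡ : ∀ A B → ICKid ((A ∧' B) ⇒ A)
  ∧-elimˡ A B = usubst (instantiate A B bot) (axiom ax-∧E₁)

  ∧-elimʳ : ∀ A B → ICKid ((A ∧' B) ⇒ B)
  ∧-elimʳ A B = usubst (instantiate A B bot) (axiom ax-∧E₂)

  ∧-intro : ∀ A B → ICKid (A ⇒ (B ⇒ (A ∧' B)))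
  ∧-intro A B = usubst (instantiate A B bot) (axiom ax-∧I)

  ∨-introˡ : ∀ A B → ICKid (A ⇒ (A ∨' B))
  ∨-introˡ A B = usubst (instantiate A B bot) (axiom ax-∨I₁)

  ∨-introʳ : ∀ A B → ICKid (B ⇒ (A ∨' B))
  ∨-introʳ A B = usubst (instantiate A B bot) (axiom ax-∨I₂)

  ∨-elim : ∀ A B C → ICKid ((A ⇒ C) ⇒ ((B ⇒ C) ⇒ ((A ∨' B) ⇒ C)))
  ∨-elim A B C = usubst (instantiate A B C) (axiom ax-∨E)

  bot-elim : ∀ A → ICKid (bot ⇒ A)
  bot-elim A = usubst (instantiate A A A) (axiom ax-⊥E)

  ▷-refl : ∀ A → ICKid (A ▷ A)
  ▷-refl A = usubst (instantiate A A A) (axiom ax-id)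

  ▷-∧ : ∀ A B C → ICKid ((A ▷ (B ∧' C)) ⇔' ((A ▷ B) ∧' (A ▷ C)))
  ▷-∧ A B C = usubst (instantiate A B C) (axiom ax-C∧)

  ▷-top : ∀ A → ICKid ((A ▷ top) ⇔' top)
  ▷-top A = usubst (instantiate A A A) (axiom ax-C⊤)

  ⇒-refl : ∀ A → ICKid (A ⇒ A)
  ⇒-refl A = mp (mp (S A (A ⇒ A) A) (K A (A ⇒ A))) (K A A)

  ⇔-to : ∀ {A B} → ICKid (A ⇔' B) → ICKid (A ⇒ B)
  ⇔-to {A} {B} d = mp (∧-elimˡ (A ⇒ B) (B ⇒ A)) d

  ⇔-from : ∀ {A B} → ICKid (A ⇔' B) → ICKid (B ⇒ A)
  ⇔-from {A} {B} d = mp (∧-elimʳ (A ⇒ B) (B ⇒ A)) d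

  ⇔-intro : ∀ {A B} → ICKid (A ⇒ B) → ICKid (B ⇒ A) → ICKid (A ⇔' B)
  ⇔-intro {A} {B} d e = mp (mp (∧-intro (A ⇒ B) (B ⇒ A)) d) e

Theory : Set₂
Theory = Fm → Set₁

infix  3 _⊢_
infixl 5 _,,_

data _⊢_ (Γ : Theory) : Fm → Set₁ where
  hyp : ∀ {φ} → Γ φ → Γ ⊢ φ
  thm : ∀ {φ} → ICKid φ → Γ ⊢ φ
  mp  : ∀ {φ ψ} → Γ ⊢ φ ⇒ ψ → Γ ⊢ φ → Γ ⊢ ψ

_⊆_ : Theory → Theory → Set₁
Γ ⊆ Δ = ∀ {φ} → Γ φ → Δ φ

∅ : Theory
∅ _ = Lift _ ⊥

_,,_ : Theory → Fm → Theory
(Γ ,, A) φ = Γ φ ⊎ φ ≡ A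

⊢-mono : ∀ {Γ Δ φ} → Γ ⊆ Δ → Γ ⊢ φ → Δ ⊢ φ
⊢-mono Γ⊆Δ (hyp h) = hyp (Γ⊆Δ h)
⊢-mono Γ⊆Δ (thm d) = thm d
⊢-mono Γ⊆Δ (mp d e) = mp (⊢-mono Γ⊆Δ d) (⊢-mono Γ⊆Δ e)

∅⊢⇒ICKid : ∀ {φ} → ∅ ⊢ φ → ICKid φ
∅⊢⇒ICKid (thm d) = d
∅⊢⇒ICKid (mp d e) = mp (∅⊢⇒ICKid d) (∅⊢⇒ICKid e)

deduction : ∀ {Γ A B} → Γ ,, A ⊢ B → Γ ⊢ A ⇒ B
deduction {A = A} (hyp (inj₂ refl)) = thm (ICK.⇒-refl A)
deduction {A = A} (hyp {φ} (inj₁ h)) = mp (thm (ICK.K φ A)) (hyp h)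
deduction {A = A} (thm {φ} d) = mp (thm (ICK.K φ A)) (thm d)
deduction {A = A} (mp {φ} {ψ} d e) = mp (mp (thm (ICK.S A φ ψ)) (deduction d)) (deduction e)

assumption : ∀ {Γ A} → Γ ,, A ⊢ A
assumption = hyp (inj₂ refl)

implication-theorem : ∀ {A B} → ∅ ,, A ⊢ B → ICKid (A ⇒ B)
implication-theorem = ∅⊢⇒ICKid ∘ deduction

⇒-trans : ∀ {A B C} → ICKid (A ⇒ B) → ICKid (B ⇒ C) → ICKid (A ⇒ C)
⇒-trans ab bc = implication-theorem (mp (thm bc) (mp (thm ab) assumption))

▷-mono : ∀ {A B C} → ICKid (B ⇒ C) → ICKid ((A ▷ B) ⇒ (A ▷ C))
▷-mono {A} {B} {C} b⇒c =
  ⇒-trans (ICK.⇔-to (congR B⇔B∧C))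
    (⇒-trans (ICK.⇔-to (ICK.▷-∧ A B C)) (ICK.∧-elimʳ (A ▷ B) (A ▷ C)))
  where
  B⇔B∧C : ICKid (B ⇔' (B ∧' C))
  B⇔B∧C = ICK.⇔-intro
    (implication-theorem (mp (mp (thm (ICK.∧-intro B C)) assumption) (mp (thm b⇒c) assumption)))
    (ICK.∧-elimˡ B C)

▷-mp : ∀ A B C → ICKid ((A ▷ (B ⇒ C)) ⇒ ((A ▷ B) ⇒ (A ▷ C)))
▷-mp A B C = ∅⊢⇒ICKid (deduction (deduction
  (mp (thm (▷-mono modusPonens))
      (mp (thm (ICK.⇔-from (ICK.▷-∧ A (B ⇒ C) B)))
          (mp (mp (thm (ICK.∧-intro _ _)) (hyp (inj₁ (inj₂ refl)))) assumption)))))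
  where
  modusPonens : ICKid (((B ⇒ C) ∧' B) ⇒ C)
  modusPonens = implication-theorem
    (mp (mp (thm (ICK.∧-elimˡ (B ⇒ C) B)) assumption) (mp (thm (ICK.∧-elimʳ (B ⇒ C) B)) assumption))

▷-theorem : ∀ A {B} → ICKid B → ICKid (A ▷ B)
▷-theorem A {B} d = mp (▷-mono (mp (ICK.K B top) d)) (mp (ICK.⇔-from (ICK.▷-top A)) (ICK.⇒-refl bot))

record PrimeTheory : Set₂ where
  field
    th         : Theory
    closed     : ∀ {φ} → th ⊢ φ → th φ
    prime      : ∀ {φ ψ} → th (φ ∨' ψ) → th φ ⊎ th ψ
    consistent : ¬ th bot
open PrimeTheory public

module Lindenbaum (lem : ExcludedMiddle (lsuc 0ℓ)) (Γ : Theory) (φ : Fm) (Γ⊬φ : ¬ (Γ ⊢ φ)) where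
  open Enumeration using (enum; enum-onto)

  stage : ℕ → Theory
  stage zero    = Γ
  stage (suc n) χ = stage n χ ⊎ (χ ≡ enum n × ¬ (stage n ,, enum n ⊢ φ))

  limit : Theory
  limit χ = ∃ λ n → stage n χ

  stage-mono′ : ∀ {m n} → m ≤′ n → stage m ⊆ stage n
  stage-mono′ ≤′-refl       = id
  stage-mono′ (≤′-step m≤n) = inj₁ ∘ stage-mono′ m≤n

  stage-mono : ∀ {m n} → m ≤ n → stage m ⊆ stage n
  stage-mono = stage-mono′ ∘ ℕ.≤⇒≤′

  stage⊆limit : ∀ n → stage n ⊆ limit
  stage⊆limit n h = n , h

  compact : ∀ {ψ} → limit ⊢ ψ → ∃ λ n → stage n ⊢ ψ
  compact (hyp (n , h)) = n , hyp h
  compact (thm d) = 0 , thm d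
  compact (mp d e) with compact d | compact e
  ... | m , d′ | n , e′ =
    m ⊔ n , mp (⊢-mono (stage-mono (ℕ.m≤m⊔n m n)) d′) (⊢-mono (stage-mono (ℕ.m≤n⊔m m n)) e′)

  stage⊬φ : ∀ n → ¬ (stage n ⊢ φ)
  stage⊬φ zero = Γ⊬φ
  stage⊬φ (suc n) d = stage⊬φ n (⊢-mono stage-n d)
    where
    added⊢φ : stage n ,, enum n ⊢ φ
    added⊢φ = ⊢-mono (λ { (inj₁ h) → inj₁ h ; (inj₂ (refl , _)) → inj₂ refl }) d
    stage-n : stage (suc n) ⊆ stage n
    stage-n (inj₁ h) = h
    stage-n (inj₂ (_ , ¬d)) = ⊥-elim (¬d added⊢φ)

  limit⊬φ : ¬ (limit ⊢ φ)
  limit⊬φ d = let n , d′ = compact d in stage⊬φ n d′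

  limit-closed : ∀ {χ} → limit ⊢ χ → limit χ
  limit-closed {χ} d with enum-onto χ
  ... | n , refl = suc n , inj₂ (refl , λ d′ → limit⊬φ (mp (⊢-mono (stage⊆limit n) (deduction d′)) d))

  -- A formula left out of the limit was rejected at its stage, so it implies φ.
  missing⇒φ : ∀ {χ} → ¬ limit χ → ¬ ¬ (limit ⊢ χ ⇒ φ)
  missing⇒φ {χ} χ∉ with enum-onto χ
  ... | n , refl = λ ¬χ⇒φ → χ∉ (suc n , inj₂ (refl , λ d → ¬χ⇒φ (⊢-mono (stage⊆limit n) (deduction d))))

  limit-prime : ∀ {χ ψ} → limit (χ ∨' ψ) → limit χ ⊎ limit ψ
  limit-prime {χ} {ψ} h with lem {limit χ} | lem {limit ψ}
  ... | yes χ∈ | _      = inj₁ χ∈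
  ... | no _   | yes ψ∈ = inj₂ ψ∈
  ... | no χ∉  | no ψ∉  = ⊥-elim (missing⇒φ χ∉ λ χ⇒φ → missing⇒φ ψ∉ λ ψ⇒φ →
        limit⊬φ (mp (mp (mp (thm (ICK.∨-elim χ ψ φ)) χ⇒φ) ψ⇒φ) (hyp h)))

  limit-consistent : ¬ limit bot
  limit-consistent h = limit⊬φ (mp (thm (ICK.bot-elim φ)) (hyp h))

  extension : PrimeTheory
  extension = record
    { th = limit ; closed = limit-closed ; prime = limit-prime ; consistent = limit-consistent }

lindenbaum : ExcludedMiddle (lsuc 0ℓ) → ∀ {Γ φ} → ¬ (Γ ⊢ φ) →
             Σ PrimeTheory λ t → Γ ⊆ th t × ¬ th t φ
lindenbaum lem {Γ} {φ} Γ⊬φ =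
  extension , stage⊆limit 0 , λ φ∈ → limit⊬φ (hyp φ∈)
  where open Lindenbaum lem Γ φ Γ⊬φ

⊢-from-prime-extensions : ExcludedMiddle (lsuc 0ℓ) → ∀ {Γ φ} →
                          (∀ t → Γ ⊆ th t → th t φ) → Γ ⊢ φ
⊢-from-prime-extensions lem {Γ} {φ} all-φ with lem {Γ ⊢ φ}
... | yes d = d
... | no Γ⊬φ = let t , Γ⊆t , φ∉t = lindenbaum lem Γ⊬φ in ⊥-elim (φ∉t (all-φ t Γ⊆t))

consistency : ¬ ICKid bot
consistency d = lower (soundness bot d point (λ _ _ _ ()) (λ _ → ⊤-upset) tt)
  where
  point : Frame 0ℓ
  point = record
    { X = ⊤ ; _≤_ = λ _ _ → ⊤ ; ≤-refl = tt ; ≤-trans = λ _ _ → tt ; inhabited = tt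
    ; R = λ _ _ _ → ⊥ ; R-ext = λ _ _ _ _ _ → id , id ; frameCond = λ _ _ () }
  ⊤-upset : Upset ⊤ (λ _ _ → ⊤)
  ⊤-upset = record { mem = λ _ → ⊤ ; up = λ _ _ → tt }

module Canonical (lem : ExcludedMiddle (lsuc 0ℓ)) where

  _≤c_ : PrimeTheory → PrimeTheory → Set₂
  s ≤c t = Lift _ (th s ⊆ th t)

  Rc : Upset PrimeTheory _≤c_ → PrimeTheory → PrimeTheory → Set₂
  Rc a s t = Σ Fm λ ψ → (∀ u → mem a u ⇔ th u ψ) × (∀ {χ} → th s (ψ ▷ χ) → th t χ)

  Rc-resp : ∀ {a b s t} → (∀ u → mem a u ⇔ mem b u) → Rc a s t → Rc b s t
  Rc-resp a≡b (ψ , a≡ψ , f) = ψ , (λ u → a≡ψ u ⇔-∘ ⇔-sym (a≡b u)) , f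

  Rc-ext : ∀ a b → (∀ u → (mem a u → mem b u) × (mem b u → mem a u)) →
           ∀ s t → (Rc a s t → Rc b s t) × (Rc b s t → Rc a s t)
  Rc-ext a b a≡b s t = Rc-resp {a} {b} {s} {t} a⇔b , Rc-resp {b} {a} {s} {t} (⇔-sym ∘ a⇔b)
    where
    a⇔b : ∀ u → mem a u ⇔ mem b u
    a⇔b u = mk⇔ (proj₁ (a≡b u)) (proj₂ (a≡b u))

  base : PrimeTheory
  base = proj₁ (lindenbaum lem {∅} {bot} (consistency ∘ ∅⊢⇒ICKid))

  frame : Frame (lsuc (lsuc 0ℓ))
  frame = record
    { X = PrimeTheory ; _≤_ = _≤c_ ; ≤-refl = lift id
    ; ≤-trans = λ s≤t t≤u → lift (lower t≤u ∘ lower s≤t)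
    ; inhabited = base
    ; R = Rc ; R-ext = Rc-ext
    ; frameCond = λ _ {z = u} s≤t (ψ , a≡ψ , f) → u , (ψ , a≡ψ , f ∘ lower s≤t) , lift id
    }

  theorem∈ : ∀ t {φ} → ICKid φ → th t φ
  theorem∈ t d = closed t (thm d)

  mp∈ : ∀ t {φ ψ} → th t (φ ⇒ ψ) → th t φ → th t ψ
  mp∈ t h k = closed t (mp (hyp h) (hyp k))

  frame-identity : Identity frame
  frame-identity a s t (ψ , a≡ψ , f) = from (a≡ψ t) (f (theorem∈ s (ICK.▷-refl ψ)))

  ▷-closed : ∀ t A {B} → (λ χ → th t (A ▷ χ)) ⊢ B → th t (A ▷ B)
  ▷-closed t A (hyp h) = h
  ▷-closed t A (thm d) = theorem∈ t (▷-theorem A d)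
  ▷-closed t A (mp {B} {C} d e) =
    mp∈ t (mp∈ t (theorem∈ t (▷-mp A B C)) (▷-closed t A d)) (▷-closed t A e)

  ⇒-from-prime-theories : ∀ {A B} → (∀ t → th t A → th t B) → ICKid (A ⇒ B)
  ⇒-from-prime-theories A⊆B = implication-theorem
    (⊢-from-prime-extensions lem λ t ∅,,A⊆t → A⊆B t (∅,,A⊆t (inj₂ refl)))

  open Semantics frame

  V : Valuation
  V n = record { mem = λ t → Lift _ (th t (var n)) ; up = λ s≤t → lift ∘ lower s≤t ∘ lower }

  truth : ∀ φ t → Forces V t φ ⇔ th t φ
  truth (var n) t = mk⇔ lower lift
  truth bot t = mk⇔ (⊥-elim ∘ lower) (⊥-elim ∘ consistent t)
  truth (A ∧' B) t = mk⇔
    (λ (a , b) → mp∈ t (mp∈ t (theorem∈ t (ICK.∧-intro A B)) (to (truth A t) a)) (to (truth B t) b))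
    (λ h → from (truth A t) (mp∈ t (theorem∈ t (ICK.∧-elimˡ A B)) h)
         , from (truth B t) (mp∈ t (theorem∈ t (ICK.∧-elimʳ A B)) h))
  truth (A ∨' B) t = mk⇔
    [ mp∈ t (theorem∈ t (ICK.∨-introˡ A B)) ∘ to (truth A t)
    , mp∈ t (theorem∈ t (ICK.∨-introʳ A B)) ∘ to (truth B t) ]
    (Sum.map (from (truth A t)) (from (truth B t)) ∘ prime t)
  truth (A ⇒ B) t = mk⇔ forced⇒member member⇒forced
    where
    forced⇒member : Forces V t (A ⇒ B) → th t (A ⇒ B)
    forced⇒member h = closed t (deduction (⊢-from-prime-extensions lem λ u t,,A⊆u →
      to (truth B u) (h u (lift λ {_} k → t,,A⊆u (inj₁ k)) (from (truth A u) (t,,A⊆u (inj₂ refl))))))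
    member⇒forced : th t (A ⇒ B) → Forces V t (A ⇒ B)
    member⇒forced h u t≤u a = from (truth B u) (mp∈ u (lower t≤u h) (to (truth A u) a))
  truth (A ▷ B) t = mk⇔ forced⇒member member⇒forced
    where
    forced⇒member : Forces V t (A ▷ B) → th t (A ▷ B)
    forced⇒member h = ▷-closed t A (⊢-from-prime-extensions lem λ u A▷⊆u →
      to (truth B u) (h u (A , truth A , A▷⊆u)))
    member⇒forced : th t (A ▷ B) → Forces V t (A ▷ B)
    member⇒forced h u (ψ , A≡ψ , f) = from (truth B u) (f (mp∈ t (theorem∈ t (ICK.⇔-to (congL A⇔ψ))) h))
      where
      A⇔ψ : ICKid (A ⇔' ψ)
      A⇔ψ = ICK.⇔-intro
        (⇒-from-prime-theories λ s → to (A≡ψ s) ∘ from (truth A s))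
        (⇒-from-prime-theories λ s → to (truth A s) ∘ from (A≡ψ s))

  completeness : ∀ φ → (∀ {ℓ} (F : Frame ℓ) → Identity F → Valid F φ) → ICKid φ
  completeness φ valid = ∅⊢⇒ICKid (⊢-from-prime-extensions lem λ t _ →
    to (truth φ t) (valid frame frame-identity V t))

proposition5p4 : SoundComplete
proposition5p4 = record
  { sound    = soundness
  ; complete = λ lem → Canonical.completeness lem
  }
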